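{- For every graph $G$, $\frac{\mathrm{bw}(G)}{25} \leq \mathrm{mimw}(L(G)) \leq \mathrm{bw}(G)$.
   Context: All graphs are finite and simple. $L(G)$ is the line graph of $G$ (vertex set $E(G)$, adjacency = sharing an endpoint). For a set $S$ and a function $f:2^S\to\mathbb{Z}$ with $f(X)=f(S\setminus X)$, a branch decomposition on $S$ is a pair $(T,\delta)$ with $T$ a tree of maximum degree at most $3$ and $\delta$ a bijection from $S$ to the leaves of $T$; each edge $e$ of $T$ induces a bipartition $(A_e,\overline{A_e})$ of $S$ via the components of $T-e$. The $f$-branch-width on $S$ is the minimum over all branch decompositions on $S$ of $\max_{e\in E(T)} f(A_e)$ if $|S|\ge 2$, and $f(\emptyset)$ if $|S|\le 1$. Branch-width $\mathrm{bw}(G)$: for $X\subseteq E(G)$, let $\mathrm{mid}(X)$ be the set of vertices incident both with an edge of $X$ and with an edge of $E(G)\setminus X$, and $\eta_G(X)=|\mathrm{mid}(X)|$; $\mathrm{bw}(G)$ is the $\eta_G$-branch-width on $E(G)$. Mim-width $\mathrm{mimw}(G)$: for $X\subseteq V(G)$, $\mathrm{cutmim}_G(X)$ is the maximum size of an induced matching in the bipartite graph consisting of the edges of $G$ with one end in $X$ and the other in $V(G)\setminus X$; $\mathrm{mimw}(G)$ is the $\mathrm{cutmim}_G$-branch-width on $V(G)$. -}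

module Defs where

open import Data.Nat using (ℕ; zero; suc; _≤_)
open import Data.Fin using (Fin; _≟_)
open import Data.Fin.Properties using (any?)
open import Data.Fin.Subset using (Subset; _∈_; _∉_; ∣_∣; inside; outside)
                            renaming (⊥ to ∅)
open import Data.Fin.Subset.Properties using (_∈?_)
open import Data.Bool using (Bool; true; false; _∧_)
open import Data.Vec using (tabulate)
open import Data.List using (List; []; _∷_; _++_; [_]; length; filter)
open import Data.List.Relation.Unary.Unique.Propositional using (Unique)
open import Data.List.Relation.Unary.Linked using (Linked)
open import Data.Product using (Σ; ∃; _×_; _,_)
open import Data.Sum using (_⊎_)
open import Data.Empty using (⊥)
open import Relation.Nullary using (¬_; Dec; ⌊_⌋; ¬?)
open import Relation.Nullary.Decidable using (_⊎-dec_; _×-dec_)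
open import Relation.Binary.PropositionalEquality using (_≡_; _≢_)
open import Relation.Binary.Construct.Closure.ReflexiveTransitive using (Star)
open import Data.List using (allFin)

record Graph : Set where
  field
    n    : ℕ
    m    : ℕ
    src  : Fin m → Fin n
    tgt  : Fin m → Fin n
    loopless : ∀ e → src e ≢ tgt e
    noParallel : ∀ e f → src e ≡ src f → tgt e ≡ tgt f → e ≡ f
    noParallel' : ∀ e f → src e ≡ tgt f → tgt e ≡ src f → e ≡ f

open Graph public

Inc : (G : Graph) → Fin (n G) → Fin (m G) → Set
Inc G v e = src G e ≡ v ⊎ tgt G e ≡ v

Inc? : (G : Graph) → (v : Fin (n G)) → (e : Fin (m G)) → Dec (Inc G v e)
Inc? G v e = (src G e ≟ v) ⊎-dec (tgt G e ≟ v)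

Adj : (G : Graph) → Fin (n G) → Fin (n G) → Set
Adj G a b = ∃ λ e → (src G e ≡ a × tgt G e ≡ b) ⊎ (src G e ≡ b × tgt G e ≡ a)

deg : (G : Graph) → Fin (n G) → ℕ
deg G v = length (filter (Inc? G v) (allFin (m G)))

AdjMinus : (G : Graph) → Fin (m G) → Fin (n G) → Fin (n G) → Set
AdjMinus G e a b = ∃ λ f → f ≢ e × ((src G f ≡ a × tgt G f ≡ b) ⊎ (src G f ≡ b × tgt G f ≡ a))

Connected : Graph → Set
Connected G = ∀ a b → Star (Adj G) a b

IsCycle : (G : Graph) → Fin (n G) → List (Fin (n G)) → Set
IsCycle G v vs = Unique (v ∷ vs) × (3 ≤ length (v ∷ vs)) × Linked (Adj G) ((v ∷ vs) ++ [ v ])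

Acyclic : Graph → Set
Acyclic G = ∀ v vs → ¬ IsCycle G v vs

IsTree : Graph → Set
IsTree G = Connected G × Acyclic G

Leaf : (G : Graph) → Fin (n G) → Set
Leaf G v = deg G v ≡ 1

record BranchDecomposition (s : ℕ) : Set where
  field
    T       : Graph
    tree    : IsTree T
    maxDeg3 : ∀ v → deg T v ≤ 3
    δ       : Fin s → Fin (n T)
    δ-inj   : ∀ i j → δ i ≡ δ j → i ≡ j
    δ-leaf  : ∀ i → Leaf T (δ i)
    δ-onto  : ∀ v → Leaf T v → ∃ λ i → δ i ≡ v

open BranchDecomposition public

-- edge e of T induces the part X = A_e of S: the elements whose leaf lies
-- in the component of T - e containing the end (src e).
Induces : {s : ℕ} → (D : BranchDecomposition s) → Fin (m (T D)) → Subset s → Set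
Induces D e X = ∀ i → (i ∈ X → Star (AdjMinus (T D) e) (src (T D) e) (δ D i))
                    × (Star (AdjMinus (T D) e) (src (T D) e) (δ D i) → i ∈ X)

-- f-branch-width, where f : 2^S → ℕ is given by its graph F (F X k means f(X) = k).
-- IsBranchWidth s F w : the f-branch-width on S = Fin s equals w, i.e.
--  * if |S| ≤ 1 then w = f(∅);
--  * if |S| ≥ 2 then w is the minimum over decompositions of the maximum of
--    f(A_e) over tree edges e: some decomposition has all f(A_e) ≤ w, and
--    every decomposition has some edge with f(A_e) ≥ w.
IsBranchWidth : (s : ℕ) → (Subset s → ℕ → Set) → ℕ → Set
IsBranchWidth s F w =
    (s ≤ 1 → F ∅ w)
  × (2 ≤ s →
       (Σ (BranchDecomposition s) λ D → ∀ e X k → Induces D e X → F X k → k ≤ w)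
     × (∀ (D : BranchDecomposition s) → ∃ λ e → ∃ λ X → ∃ λ k →
           Induces D e X × F X k × w ≤ k))

mid : (G : Graph) → Subset (m G) → Subset (n G)
mid G X = tabulate λ v →
  ⌊ any? (λ e → (e ∈? X) ×-dec Inc? G v e) ⌋ ∧ ⌊ any? (λ e → ¬? (e ∈? X) ×-dec Inc? G v e) ⌋

Eta : (G : Graph) → Subset (m G) → ℕ → Set
Eta G X k = k ≡ ∣ mid G X ∣

IsBW : Graph → ℕ → Set
IsBW G w = IsBranchWidth (m G) (Eta G) w

record AdjGraph : Set₁ where
  field
    N     : ℕ
    A     : Fin N → Fin N → Set
    A-sym : ∀ a b → A a b → A b a
    A-irr : ∀ a → ¬ A a a

open AdjGraph public

LAdj : (G : Graph) → Fin (m G) → Fin (m G) → Set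
LAdj G e f = e ≢ f × ∃ λ v → Inc G v e × Inc G v f

LineGraph : Graph → AdjGraph
LineGraph G = record
  { N = m G
  ; A = LAdj G
  ; A-sym = λ { a b (a≢b , v , p , q) → (λ eq → a≢b (sym' eq)) , v , q , p }
  ; A-irr = λ { a (a≢a , _) → a≢a refl' }
  }
  where
  open import Relation.Binary.PropositionalEquality using () renaming (sym to sym' ; refl to refl')

-- an induced matching of size k in the bipartite graph of the edges of H
-- between X and V(H) \ X: edges x i — y i (x i ∈ X, y i ∉ X), pairwise
-- vertex-disjoint, and no edge of H between x i and y j for i ≠ j.
IsInducedCutMatching : (H : AdjGraph) → Subset (N H) → ℕ → Set
IsInducedCutMatching H X k =
  Σ (Fin k → Fin (N H)) λ x → Σ (Fin k → Fin (N H)) λ y →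
    (∀ i → x i ∈ X × y i ∉ X × A H (x i) (y i))
  × (∀ i j → i ≢ j → x i ≢ x j × y i ≢ y j × ¬ A H (x i) (y j))

CutMim : (H : AdjGraph) → Subset (N H) → ℕ → Set
CutMim H X k = IsInducedCutMatching H X k × (∀ k' → IsInducedCutMatching H X k' → k' ≤ k)

IsMimw : AdjGraph → ℕ → Set
IsMimw H w = IsBranchWidth (N H) (CutMim H) w

{-# OPTIONS --safe #-}
module Submission where

open import Defs
open import Data.Nat using (ℕ; zero; suc; _+_; _*_; _^_; _≤_; _<_; z≤n; s≤s; z<s; _≤?_)
open import Data.Nat.Properties
  using ( ≤-refl; ≤-reflexive; ≤-trans; ≤-pred; <⇒≤; <⇒≱; ≰⇒>; ≤∧≢⇒<; n≤1+n; m<m+n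
        ; +-suc; +-assoc; +-identityʳ; +-mono-≤; +-monoˡ-≤; +-monoʳ-≤; +-cancelˡ-≤
        ; *-suc; *-zeroʳ; *-assoc; *-monoˡ-≤; *-monoʳ-≤; ^-monoʳ-≤
        ; +-commutativeSemigroup; module ≤-Reasoning )
open import Data.Nat.Induction using (<-wellFounded)
open import Data.Nat.ListAction using (sum)
open import Data.Bool using (Bool; true; false; not; _∧_; if_then_else_) renaming (_≟_ to _≟ᵇ_)
open import Data.Bool.Properties using (∧-conicalʳ)
open import Data.Maybe using (Maybe; just; nothing)
open import Data.Fin using (Fin; zero; suc; _≟_)
open import Data.Fin.Properties using (any?; all?; injective⇒≤)
open import Data.Fin.Subset using (Subset; ∣_∣) renaming (_∈_ to _∈ₛ_; _∉_ to _∉ₛ_)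
open import Data.Fin.Subset.Properties using () renaming (_∈?_ to _∈ₛ?_)
open import Data.Vec using (Vec; []; _∷_; replicate; lookup; _[_]≔_) renaming (tabulate to tabulateᵥ)
open import Data.Vec.Properties using (lookup∘update; lookup∘update′; tabulate-cong)
import Data.Vec.Functional as Vector
import Data.List as List
open import Data.List using (List; []; _∷_; [_]; length; filter; map; allFin; tabulate)
open import Data.List.Properties using (filter-notAll; length-map; length-tabulate)
open import Data.List.Relation.Unary.All as All using (All; []; _∷_)
open import Data.List.Relation.Unary.All.Properties using (¬Any⇒All¬)
open import Data.List.Relation.Unary.Any as Any using (Any; here; there)
open import Data.List.Relation.Unary.Unique.Propositional using (Unique; []; _∷_)
open import Data.List.Relation.Unary.Unique.Propositional.Properties using (filter⁺; allFin⁺; tabulate⁺)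
open import Data.List.Relation.Binary.Subset.Propositional using (_⊆_)
open import Data.List.Membership.Propositional using (_∈_; _∉_; find)
open import Data.List.Membership.Propositional.Properties
  using (∈-filter⁺; ∈-filter⁻; ∈-lookup; ∈-allFin; ∈-tabulate⁻)
open import Data.Product using (∃; _×_; _,_; proj₁; proj₂)
open import Data.Sum using (_⊎_; inj₁; inj₂)
open import Function using (_∘_)
open import Induction.WellFounded using (Acc; acc)
open import Relation.Nullary using (¬_; Dec; yes; no; does; contradiction)
open import Relation.Nullary.Decidable using (_×-dec_; _→-dec_; ¬?; map′; isYes≗does)
open import Relation.Unary using (Decidable)
open import Relation.Binary.Core using (_Preserves_⟶_)
open import Relation.Binary.Definitions using (DecidableEquality)
open import Relation.Binary.PropositionalEquality
  using (_≡_; _≢_; _≗_; refl; sym; trans; cong; cong₂; subst; module ≡-Reasoning)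
open import Algebra.Properties.CommutativeSemigroup +-commutativeSemigroup using (x∙yz≈y∙xz)

-- Fix a cut X of E(G). An induced matching x₁y₁, …, x_ky_k of L(G) across X
-- gives distinct vertices of mid(X), namely the common ends of xᵢ and yᵢ, so
-- cutmim(X) ≤ η(X). Conversely, choose for every v ∈ mid(X) an edge v v⁺ in X
-- and an edge v v⁻ outside X. Some 2-colouring c of V(G) makes at least an
-- eighth of these v good, i.e. c v = c v⁻ = 1 and c v⁺ = 0 (the expected
-- number is |mid(X)|/8; we derandomise by conditional expectations). The map
-- v ↦ v⁻ has no fixed points, so a third of the good vertices form a set T
-- with v⁻ ∉ T for v ∈ T, and then the edges v v⁺, v v⁻ (v ∈ T) form an induced
-- matching across X: the colours rule out every common end of two of these
-- edges except u = w⁻ for u, w ∈ T, which T avoids.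
-- Hence η(X) ≤ 24 cutmim(X), and both bounds pass from cuts to widths by
-- evaluating an optimal decomposition for one width in the other.

*-length≤sum : ∀ {A : Set} (f : A → ℕ) {k} {xs : List A} → All (λ x → k ≤ f x) xs →
  k * length xs ≤ sum (map f xs)
*-length≤sum f {k} []                     = ≤-reflexive (*-zeroʳ k)
*-length≤sum f {k} {x ∷ xs} (k≤fx ∷ k≤f) = begin
  k * suc (length xs)   ≡⟨ *-suc k (length xs) ⟩
  k + k * length xs     ≤⟨ +-mono-≤ k≤fx (*-length≤sum f k≤f) ⟩
  f x + sum (map f xs)  ∎
  where open ≤-Reasoning

length-filter+filter-∁ : ∀ {A : Set} {P : A → Set} (P? : Decidable P) xs →
  length (filter P? xs) + length (filter (¬? ∘ P?) xs) ≡ length xs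
length-filter+filter-∁ P? []       = refl
length-filter+filter-∁ P? (x ∷ xs) with P? x
... | yes _ = cong suc (length-filter+filter-∁ P? xs)
... | no _  = trans (+-suc _ _) (cong suc (length-filter+filter-∁ P? xs))

lookup-injective : ∀ {A : Set} {xs : List A} → Unique xs →
  ∀ {i j} → List.lookup xs i ≡ List.lookup xs j → i ≡ j
lookup-injective {xs = _ ∷ _} _          {zero}  {zero}  _  = refl
lookup-injective {xs = _ ∷ _} (x∉xs ∷ _) {zero}  {suc j} eq =
  contradiction eq (All.lookup x∉xs (∈-lookup j))
lookup-injective {xs = _ ∷ _} (x∉xs ∷ _) {suc i} {zero}  eq =
  contradiction (sym eq) (All.lookup x∉xs (∈-lookup i))
lookup-injective {xs = _ ∷ _} (_ ∷ xs!)  {suc i} {suc j} eq = cong suc (lookup-injective xs! eq)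

[]-or-∈ : ∀ {A : Set} (xs : List A) → xs ≡ [] ⊎ ∃ (_∈ xs)
[]-or-∈ []      = inj₁ refl
[]-or-∈ (x ∷ _) = inj₂ (x , here refl)

∣tabulate-does∣ : ∀ {A : Set} {P : A → Set} (P? : Decidable P) {k} (f : Fin k → A) →
  ∣ tabulateᵥ (does ∘ P? ∘ f) ∣ ≡ length (filter P? (tabulate f))
∣tabulate-does∣ P? {zero}  f = refl
∣tabulate-does∣ P? {suc k} f with P? (f zero)
... | yes _ = cong suc (∣tabulate-does∣ P? (f ∘ suc))
... | no _  = ∣tabulate-does∣ P? (f ∘ suc)

module _ {A : Set} (_≟_ : DecidableEquality A) where

  Unique⊆⇒length≤ : ∀ {xs ys : List A} → Unique xs → xs ⊆ ys → length xs ≤ length ys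
  Unique⊆⇒length≤ {[]}     _             _        = z≤n
  Unique⊆⇒length≤ {x ∷ xs} {ys} (x∉xs ∷ xs!) x∷xs⊆ys =
    ≤-trans (s≤s (Unique⊆⇒length≤ xs! xs⊆ys-x)) (filter-notAll ≢x? ys x∈ys)
    where
    ≢x? : Decidable (x ≢_)
    ≢x? y = ¬? (x ≟ y)
    xs⊆ys-x : xs ⊆ filter ≢x? ys
    xs⊆ys-x z∈xs = ∈-filter⁺ ≢x? (x∷xs⊆ys (there z∈xs)) (All.lookup x∉xs z∈xs)
    x∈ys : Any (λ y → ¬ x ≢ y) ys
    x∈ys = Any.map (λ x≡y x≢y → x≢y x≡y) (x∷xs⊆ys (here refl))

  Unique⇒count≤1 : ∀ a {xs : List A} → Unique xs → length (filter (a ≟_) xs) ≤ 1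
  Unique⇒count≤1 a {xs} xs! = Unique⊆⇒length≤ {ys = [ a ]} (filter⁺ (a ≟_) {xs} xs!)
    (λ z∈ → here (sym (proj₂ (∈-filter⁻ (a ≟_) {xs = xs} z∈))))

-- Independent sets in functional digraphs

module _ {A : Set} (g : A → A) where

  Independent : List A → Set
  Independent T = ∀ {v} → v ∈ T → g v ∉ T

module _ {A : Set} (_≟_ : DecidableEquality A) (g : A → A) where

  open import Data.List.Membership.DecPropositional _≟_ using (_∈?_; _∉?_)

  indegree : List A → A → ℕ
  indegree S u = length (filter (λ v → g v ≟ u) S)

  sum-indegree-∷ : ∀ v S U →
    sum (map (indegree (v ∷ S)) U) ≡ length (filter (g v ≟_) U) + sum (map (indegree S) U)
  sum-indegree-∷-step : ∀ v S u U →
    indegree S u + sum (map (indegree (v ∷ S)) U)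
      ≡ length (filter (g v ≟_) U) + (indegree S u + sum (map (indegree S) U))

  sum-indegree-∷ v S []      = refl
  sum-indegree-∷ v S (u ∷ U) with g v ≟ u
  ... | yes _ = cong suc (sum-indegree-∷-step v S u U)
  ... | no _  = sum-indegree-∷-step v S u U

  sum-indegree-∷-step v S u U = trans (cong (indegree S u +_) (sum-indegree-∷ v S U))
    (x∙yz≈y∙xz (indegree S u) (length (filter (g v ≟_) U)) (sum (map (indegree S) U)))

  sum-indegree≤length : ∀ S {U} → Unique U → sum (map (indegree S) U) ≤ length S
  sum-indegree≤length []      {[]}    _        = z≤n
  sum-indegree≤length []      {_ ∷ _} (_ ∷ U!) = sum-indegree≤length [] U!
  sum-indegree≤length (v ∷ S) {U}     U!       = begin
    sum (map (indegree (v ∷ S)) U)                         ≡⟨ sum-indegree-∷ v S U ⟩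
    length (filter (g v ≟_) U) + sum (map (indegree S) U)  ≤⟨ +-mono-≤ (Unique⇒count≤1 _≟_ (g v) U!)
                                                                        (sum-indegree≤length S U!) ⟩
    suc (length S)                                         ∎
    where open ≤-Reasoning

  ∃-indegree≤1 : ∀ {x S} → Unique (x ∷ S) → ∃ λ u → u ∈ x ∷ S × indegree (x ∷ S) u ≤ 1
  ∃-indegree≤1 {x} {S} S! with Any.any? (λ u → indegree (x ∷ S) u ≤? 1) (x ∷ S)
  ... | yes some = find some
  ... | no none  = contradiction (sum-indegree≤length (x ∷ S) S!) (<⇒≱ (begin-strict
    length (x ∷ S)                        <⟨ m<m+n (length (x ∷ S)) z<s ⟩
    length (x ∷ S) + length (x ∷ S)       ≡⟨ cong (length (x ∷ S) +_) (sym (+-identityʳ _)) ⟩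
    2 * length (x ∷ S)                    ≤⟨ *-length≤sum (indegree (x ∷ S))
                                                (All.map ≰⇒> (¬Any⇒All¬ _ none)) ⟩
    sum (map (indegree (x ∷ S)) (x ∷ S))  ∎))
    where open ≤-Reasoning

  closedNbhd : List A → A → List A
  closedNbhd S u = u ∷ g u ∷ filter (λ v → g v ≟ u) S

  deleteNbhd : List A → A → List A
  deleteNbhd S u = filter (_∉? closedNbhd S u) S

  length≤3+deleteNbhd : ∀ {S u} → Unique S → indegree S u ≤ 1 →
    length S ≤ 3 + length (deleteNbhd S u)
  length≤3+deleteNbhd {S} {u} S! indeg≤1 = begin
    length S                                               ≡⟨ sym (length-filter+filter-∁ (_∈? Nbhd) S) ⟩
    length (filter (_∈? Nbhd) S) + length (deleteNbhd S u) ≤⟨ +-monoˡ-≤ _ Nbhd∩S≤Nbhd ⟩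
    length Nbhd + length (deleteNbhd S u)                  ≤⟨ +-monoˡ-≤ _ (s≤s (s≤s indeg≤1)) ⟩
    3 + length (deleteNbhd S u)                            ∎
    where
    open ≤-Reasoning
    Nbhd = closedNbhd S u
    Nbhd∩S≤Nbhd : length (filter (_∈? Nbhd) S) ≤ length Nbhd
    Nbhd∩S≤Nbhd = Unique⊆⇒length≤ _≟_ (filter⁺ (_∈? Nbhd) S!) (proj₂ ∘ ∈-filter⁻ (_∈? Nbhd) {xs = S})

  length-deleteNbhd< : ∀ {S u} → u ∈ S → length (deleteNbhd S u) < length S
  length-deleteNbhd< {S} {u} u∈S =
    filter-notAll (_∉? closedNbhd S u) S (Any.map (λ u≡y y∉N → y∉N (here (sym u≡y))) u∈S)

  ∈-deleteNbhd⁻ : ∀ {S u v} → v ∈ deleteNbhd S u → v ∈ S × v ≢ u × v ≢ g u × g v ≢ u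
  ∈-deleteNbhd⁻ {S} {u} v∈ with ∈-filter⁻ (_∉? closedNbhd S u) {xs = S} v∈
  ... | v∈S , v∉N =
    v∈S , v∉N ∘ here , v∉N ∘ there ∘ here , v∉N ∘ there ∘ there ∘ ∈-filter⁺ (λ v → g v ≟ u) v∈S

  -- Greedy: keeping a vertex u of in-degree ≤ 1 costs only the at most three
  -- vertices of closedNbhd S u.
  ∃-independent-third : ∀ S → Unique S → (∀ {v} → v ∈ S → g v ≢ v) →
    ∃ λ T → T ⊆ S × Unique T × Independent g T × length S ≤ 3 * length T
  ∃-independent-third S = go S (<-wellFounded (length S))
    where
    go : ∀ S → Acc _<_ (length S) → Unique S → (∀ {v} → v ∈ S → g v ≢ v) →
      ∃ λ T → T ⊆ S × Unique T × Independent g T × length S ≤ 3 * length T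
    go [] _ _ _ = [] , (λ ()) , [] , (λ ()) , z≤n
    go S@(_ ∷ _) (acc rec) S! noFix with ∃-indegree≤1 S!
    ... | u , u∈S , indeg≤1
        with go (deleteNbhd S u) (rec (length-deleteNbhd< u∈S))
                (filter⁺ (_∉? closedNbhd S u) S!) (noFix ∘ proj₁ ∘ ∈-deleteNbhd⁻)
    ...   | T , T⊆S′ , T! , T-indep , S′≤3T = u ∷ T , u∷T⊆S , All.tabulate u≢ ∷ T! , indep , bound
      where
      u∷T⊆S : u ∷ T ⊆ S
      u∷T⊆S (here refl)  = u∈S
      u∷T⊆S (there v∈T) = proj₁ (∈-deleteNbhd⁻ (T⊆S′ v∈T))
      u≢ : ∀ {v} → v ∈ T → u ≢ v
      u≢ v∈T u≡v = proj₁ (proj₂ (∈-deleteNbhd⁻ (T⊆S′ v∈T))) (sym u≡v)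
      indep : Independent g (u ∷ T)
      indep (here refl)  (here gu≡u)  = noFix u∈S gu≡u
      indep (here refl)  (there gu∈T) = proj₁ (proj₂ (proj₂ (∈-deleteNbhd⁻ (T⊆S′ gu∈T)))) refl
      indep (there v∈T) (here gv≡u)  = proj₂ (proj₂ (proj₂ (∈-deleteNbhd⁻ (T⊆S′ v∈T)))) gv≡u
      indep (there v∈T) (there gv∈T) = T-indep v∈T gv∈T
      bound : length S ≤ 3 * length (u ∷ T)
      bound = begin
        length S                     ≤⟨ length≤3+deleteNbhd S! indeg≤1 ⟩
        3 + length (deleteNbhd S u)  ≤⟨ +-monoʳ-≤ 3 S′≤3T ⟩
        3 + 3 * length T             ≡⟨ sym (*-suc 3 (length T)) ⟩
        3 * length (u ∷ T)           ∎
        where open ≤-Reasoning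

-- Random 2-colourings, derandomised

PartialAssignment : ℕ → Set
PartialAssignment = Vec (Maybe Bool)

agrees : Bool → Maybe Bool → Bool
agrees b     nothing  = true
agrees true  (just a) = a
agrees false (just a) = not a

extends : ∀ {n} → Vec Bool n → PartialAssignment n → Bool
extends []      []      = true
extends (b ∷ c) (m ∷ t) = agrees b m ∧ extends c t

#fixed : ∀ {n} → PartialAssignment n → ℕ
#fixed []            = 0
#fixed (nothing ∷ t) = #fixed t
#fixed (just _ ∷ t)  = suc (#fixed t)

-- A uniformly random c extends t with probability 2 ^ - #fixed t, so the
-- average of score c ts over all c is length ts.
weight : ∀ {n} → Vec Bool n → PartialAssignment n → ℕ
weight c t = if extends c t then 2 ^ #fixed t else 0

score : ∀ {n} → Vec Bool n → List (PartialAssignment n) → ℕ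
score c []       = 0
score c (t ∷ ts) = weight c t + score c ts

-- A partial assignment fixing the first coordinate to b loses that fixed
-- coordinate, so it is kept twice to keep its weight.
condition : ∀ {n} → Bool → List (PartialAssignment (suc n)) → List (PartialAssignment n)
condition b []                   = []
condition b ((nothing ∷ t) ∷ ts) = t ∷ condition b ts
condition b ((just a ∷ t) ∷ ts)  =
  if agrees b (just a) then t ∷ t ∷ condition b ts else condition b ts

length-condition : ∀ {n} (ts : List (PartialAssignment (suc n))) →
  length (condition true ts) + length (condition false ts) ≡ length ts + length ts
length-condition []             = refl
length-condition ((m ∷ t) ∷ ts) =
  trans (first m) (trans (cong (2 +_) (length-condition ts)) (cong suc (sym (+-suc _ _))))
  where
  first : ∀ m → length (condition true ((m ∷ t) ∷ ts)) + length (condition false ((m ∷ t) ∷ ts))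
              ≡ 2 + (length (condition true ts) + length (condition false ts))
  first nothing      = cong suc (+-suc _ _)
  first (just true)  = refl
  first (just false) = trans (+-suc _ _) (cong suc (+-suc _ _))

∃-length≤condition : ∀ {n} (ts : List (PartialAssignment (suc n))) →
  ∃ λ b → length ts ≤ length (condition b ts)
∃-length≤condition ts with length ts ≤? length (condition true ts)
... | yes ≤true = true , ≤true
... | no ≰true  = false , +-cancelˡ-≤ (length ts) _ _ (begin
  length ts + length ts                                     ≡⟨ sym (length-condition ts) ⟩
  length (condition true ts) + length (condition false ts)  ≤⟨ +-monoˡ-≤ _ (<⇒≤ (≰⇒> ≰true)) ⟩
  length ts + length (condition false ts)                   ∎)
  where open ≤-Reasoning

if-double : ∀ x k → (if x then 2 * k else 0) ≡ (if x then k else 0) + (if x then k else 0)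
if-double true  k = cong (k +_) (+-identityʳ k)
if-double false k = refl

score-condition : ∀ {n} b (c : Vec Bool n) ts → score (b ∷ c) ts ≡ score c (condition b ts)
score-condition b c []                   = refl
score-condition b c ((nothing ∷ t) ∷ ts) = cong (_ +_) (score-condition b c ts)
score-condition b c ((just a ∷ t) ∷ ts) with agrees b (just a)
... | false = score-condition b c ts
... | true  = trans (cong₂ _+_ (if-double (extends c t) (2 ^ #fixed t)) (score-condition b c ts))
                    (+-assoc (weight c t) (weight c t) _)

score-[] : (ts : List (PartialAssignment 0)) → score [] ts ≡ length ts
score-[] []        = refl
score-[] ([] ∷ ts) = cong suc (score-[] ts)

∃-length≤score : ∀ n (ts : List (PartialAssignment n)) → ∃ λ c → length ts ≤ score c ts
∃-length≤score zero    ts = [] , ≤-reflexive (sym (score-[] ts))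
∃-length≤score (suc n) ts with ∃-length≤condition ts
... | b , ≤cond with ∃-length≤score n (condition b ts)
...   | c , ≤score =
  b ∷ c , ≤-trans ≤cond (≤-trans ≤score (≤-reflexive (sym (score-condition b c ts))))

∃-colouring-extending-eighth : ∀ {A : Set} {n} (f : A → PartialAssignment n) →
  (∀ a → #fixed (f a) ≤ 3) → (xs : List A) →
  ∃ λ c → length xs ≤ 8 * length (filter (λ a → extends c (f a) ≟ᵇ true) xs)
∃-colouring-extending-eighth {n = n} f ≤3 xs with ∃-length≤score n (map f xs)
... | c , ≤score = c , (begin
  length xs                                               ≡⟨ sym (length-map f xs) ⟩
  length (map f xs)                                       ≤⟨ ≤score ⟩
  score c (map f xs)                                      ≤⟨ score≤ xs ⟩
  8 * length (filter (λ a → extends c (f a) ≟ᵇ true) xs)  ∎)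
  where
  open ≤-Reasoning
  score≤ : ∀ xs → score c (map f xs) ≤ 8 * length (filter (λ a → extends c (f a) ≟ᵇ true) xs)
  score≤ []       = z≤n
  score≤ (a ∷ xs) with extends c (f a)
  ... | true  = ≤-trans (+-mono-≤ (^-monoʳ-≤ 2 (≤3 a)) (score≤ xs)) (≤-reflexive (sym (*-suc 8 _)))
  ... | false = score≤ xs

#fixed-replicate : ∀ n → #fixed (replicate n nothing) ≡ 0
#fixed-replicate zero    = refl
#fixed-replicate (suc n) = #fixed-replicate n

#fixed-[]≔ : ∀ {n} (t : PartialAssignment n) i a → #fixed (t [ i ]≔ just a) ≤ suc (#fixed t)
#fixed-[]≔ (nothing ∷ t) zero    a = ≤-refl
#fixed-[]≔ (just _ ∷ t)  zero    a = n≤1+n _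
#fixed-[]≔ (nothing ∷ t) (suc i) a = #fixed-[]≔ t i a
#fixed-[]≔ (just _ ∷ t)  (suc i) a = s≤s (#fixed-[]≔ t i a)

extends-lookup : ∀ {n} (c : Vec Bool n) t {i a} →
  extends c t ≡ true → lookup t i ≡ just a → lookup c i ≡ a
extends-lookup (true ∷ c)  (just true ∷ t)  {zero}  _   refl = refl
extends-lookup (false ∷ c) (just false ∷ t) {zero}  _   refl = refl
extends-lookup (b ∷ c)     (m ∷ t)          {suc i} c⊒t eq   =
  extends-lookup c t (∧-conicalʳ (agrees b m) (extends c t) c⊒t) eq

-- Cuts of a graph and of its line graph

module _ (G : Graph) where

  opposite : Fin (m G) → Fin (n G) → Fin (n G)
  opposite e v with src G e ≟ v
  ... | yes _ = tgt G e
  ... | no _  = src G e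

  Inc⇒ends : ∀ {v e} → Inc G v e →
    (src G e ≡ v × tgt G e ≡ opposite e v) ⊎ (tgt G e ≡ v × src G e ≡ opposite e v)
  Inc⇒ends {v} {e} v∈e with src G e ≟ v | v∈e
  ... | yes src≡v | _          = inj₁ (src≡v , refl)
  ... | no src≢v  | inj₁ src≡v = contradiction src≡v src≢v
  ... | no _      | inj₂ tgt≡v = inj₂ (tgt≡v , refl)

  Inc⇒≡∨≡opposite : ∀ {v w e} → Inc G v e → Inc G w e → w ≡ v ⊎ w ≡ opposite e v
  Inc⇒≡∨≡opposite v∈e (inj₁ src≡w) with Inc⇒ends v∈e
  ... | inj₁ (src≡v , _) = inj₁ (trans (sym src≡w) src≡v)
  ... | inj₂ (_ , src≡o) = inj₂ (trans (sym src≡w) src≡o)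
  Inc⇒≡∨≡opposite v∈e (inj₂ tgt≡w) with Inc⇒ends v∈e
  ... | inj₁ (_ , tgt≡o) = inj₂ (trans (sym tgt≡w) tgt≡o)
  ... | inj₂ (tgt≡v , _) = inj₁ (trans (sym tgt≡w) tgt≡v)

  opposite-≢ : ∀ {v e} → Inc G v e → opposite e v ≢ v
  opposite-≢ {e = e} v∈e o≡v with Inc⇒ends v∈e
  ... | inj₁ (src≡v , tgt≡o) = loopless G e (trans src≡v (sym (trans tgt≡o o≡v)))
  ... | inj₂ (tgt≡v , src≡o) = loopless G e (trans (trans src≡o o≡v) (sym tgt≡v))

  opposite-injective : ∀ {v e f} → Inc G v e → Inc G v f → opposite e v ≡ opposite f v → e ≡ f
  opposite-injective {e = e} {f} v∈e v∈f o≡o with Inc⇒ends v∈e | Inc⇒ends v∈f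
  ... | inj₁ (e₀ , e₁) | inj₁ (f₀ , f₁) =
    noParallel  G e f (trans e₀ (sym f₀)) (trans e₁ (trans o≡o (sym f₁)))
  ... | inj₁ (e₀ , e₁) | inj₂ (f₀ , f₁) =
    noParallel' G e f (trans e₀ (sym f₀)) (trans e₁ (trans o≡o (sym f₁)))
  ... | inj₂ (e₀ , e₁) | inj₁ (f₀ , f₁) =
    noParallel' G e f (trans e₁ (trans o≡o (sym f₁))) (trans e₀ (sym f₀))
  ... | inj₂ (e₀ , e₁) | inj₂ (f₀ , f₁) =
    noParallel  G e f (trans e₁ (trans o≡o (sym f₁))) (trans e₀ (sym f₀))

  LAdj? : ∀ e f → Dec (LAdj G e f)
  LAdj? e f = ¬? (e ≟ f) ×-dec any? (λ v → Inc? G v e ×-dec Inc? G v f)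

emptyInducedCutMatching : ∀ H X → IsInducedCutMatching H X 0
emptyInducedCutMatching _ _ = (λ ()) , (λ ()) , (λ ()) , (λ ())

module _ (G : Graph) (X : Subset (m G)) where

  MidVertex : Fin (n G) → Set
  MidVertex v = (∃ λ e → e ∈ₛ X × Inc G v e) × (∃ λ e → e ∉ₛ X × Inc G v e)

  midVertex? : Decidable MidVertex
  midVertex? v = any? (λ e → (e ∈ₛ? X) ×-dec Inc? G v e)
           ×-dec any? (λ e → ¬? (e ∈ₛ? X) ×-dec Inc? G v e)

  midList : List (Fin (n G))
  midList = filter midVertex? (allFin (n G))

  ∈-midList⁻ : ∀ {v} → v ∈ midList → MidVertex v
  ∈-midList⁻ = proj₂ ∘ ∈-filter⁻ midVertex? {xs = allFin (n G)}

  ∣mid∣≡length-midList : ∣ mid G X ∣ ≡ length midList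
  ∣mid∣≡length-midList = trans
    (cong ∣_∣ (tabulate-cong λ v → cong₂ _∧_
      (isYes≗does (any? (λ e → (e ∈ₛ? X) ×-dec Inc? G v e)))
      (isYes≗does (any? (λ e → ¬? (e ∈ₛ? X) ×-dec Inc? G v e)))))
    (∣tabulate-does∣ midVertex? (λ v → v))

  inducedCutMatching⇒≤∣mid∣ : ∀ {k} → IsInducedCutMatching (LineGraph G) X k → k ≤ ∣ mid G X ∣
  inducedCutMatching⇒≤∣mid∣ {k} (x , y , edge , induced) = begin
    k                    ≡⟨ sym (length-tabulate w) ⟩
    length (tabulate w)  ≤⟨ Unique⊆⇒length≤ _≟_ (tabulate⁺ w-injective) w⊆midList ⟩
    length midList       ≡⟨ sym ∣mid∣≡length-midList ⟩
    ∣ mid G X ∣          ∎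
    where
    open ≤-Reasoning
    common : ∀ i → ∃ λ v → Inc G v (x i) × Inc G v (y i)
    common i = let (_ , _ , _ , xi∩yi) = edge i in xi∩yi
    w : Fin k → Fin (n G)
    w i = proj₁ (common i)
    w-injective : ∀ {i j} → w i ≡ w j → i ≡ j
    w-injective {i} {j} wi≡wj with i ≟ j
    ... | yes i≡j = i≡j
    ... | no i≢j  = contradiction
      (xi≢yj , w i , proj₁ (proj₂ (common i))
             , subst (λ v → Inc G v (y j)) (sym wi≡wj) (proj₂ (proj₂ (common j))))
      (proj₂ (proj₂ (induced i j i≢j)))
      where
      xi≢yj : x i ≢ y j
      xi≢yj xi≡yj = proj₁ (proj₂ (edge j)) (subst (_∈ₛ X) xi≡yj (proj₁ (edge i)))
    w⊆midList : ∀ {v} → v ∈ tabulate w → v ∈ midList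
    w⊆midList v∈w with ∈-tabulate⁻ v∈w
    ... | i , refl = ∈-filter⁺ midVertex? (∈-allFin (w i))
      ( (x i , proj₁ (edge i) , proj₁ (proj₂ (common i)))
      , (y i , proj₁ (proj₂ (edge i)) , proj₂ (proj₂ (common i))) )

  -- inner and outer return default off mid(X), where their values are never used.
  module _ (default : Fin (m G)) where

    inner outer : Fin (n G) → Fin (m G)
    inner v with midVertex? v
    ... | yes ((e , _) , _) = e
    ... | no _              = default
    outer v with midVertex? v
    ... | yes (_ , (e , _)) = e
    ... | no _              = default

    inner-spec : ∀ {v} → MidVertex v → inner v ∈ₛ X × Inc G v (inner v)
    inner-spec {v} mid-v with midVertex? v
    ... | yes ((_ , spec) , _) = spec
    ... | no ¬mid-v            = contradiction mid-v ¬mid-v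

    outer-spec : ∀ {v} → MidVertex v → outer v ∉ₛ X × Inc G v (outer v)
    outer-spec {v} mid-v with midVertex? v
    ... | yes (_ , (_ , spec)) = spec
    ... | no ¬mid-v            = contradiction mid-v ¬mid-v

    inner-end outer-end : Fin (n G) → Fin (n G)
    inner-end v = opposite G (inner v) v
    outer-end v = opposite G (outer v) v

    inner-end≢outer-end : ∀ {v} → MidVertex v → inner-end v ≢ outer-end v
    inner-end≢outer-end mid-v ends≡ = proj₁ (outer-spec mid-v)
      (subst (_∈ₛ X) (opposite-injective G (proj₂ (inner-spec mid-v)) (proj₂ (outer-spec mid-v)) ends≡)
             (proj₁ (inner-spec mid-v)))

    record Good (c : Vec Bool (n G)) (v : Fin (n G)) : Set where
      field
        mid-vertex      : MidVertex v
        self-true       : lookup c v ≡ true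
        inner-end-false : lookup c (inner-end v) ≡ false
        outer-end-true  : lookup c (outer-end v) ≡ true

    constraint : Fin (n G) → PartialAssignment (n G)
    constraint v = ((replicate (n G) nothing [ outer-end v ]≔ just true) [ v ]≔ just true)
                     [ inner-end v ]≔ just false

    #fixed-constraint : ∀ v → #fixed (constraint v) ≤ 3
    #fixed-constraint v =
      ≤-trans (#fixed-[]≔ t₂ (inner-end v) false) (s≤s (
      ≤-trans (#fixed-[]≔ t₁ v true) (s≤s (
      ≤-trans (#fixed-[]≔ t₀ (outer-end v) true) (s≤s (≤-reflexive (#fixed-replicate (n G))))))))
      where
      t₀ = replicate (n G) nothing
      t₁ = t₀ [ outer-end v ]≔ just true
      t₂ = t₁ [ v ]≔ just true

    extends-constraint⇒Good : ∀ c {v} → MidVertex v → extends c (constraint v) ≡ true → Good c v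
    extends-constraint⇒Good c {v} mid-v c⊒v = record
      { mid-vertex      = mid-v
      ; self-true       = extends-lookup c (constraint v) c⊒v (begin
          lookup (constraint v) v  ≡⟨ lookup∘update′ (inner-end≢ ∘ sym) t₂ (just false) ⟩
          lookup t₂ v              ≡⟨ lookup∘update v t₁ (just true) ⟩
          just true                ∎)
      ; inner-end-false = extends-lookup c (constraint v) c⊒v (lookup∘update (inner-end v) t₂ (just false))
      ; outer-end-true  = extends-lookup c (constraint v) c⊒v (begin
          lookup (constraint v) (outer-end v)  ≡⟨ lookup∘update′ (inner-end≢outer-end mid-v ∘ sym)
                                                                  t₂ (just false) ⟩
          lookup t₂ (outer-end v)              ≡⟨ lookup∘update′ outer-end≢ t₁ (just true) ⟩
          lookup t₁ (outer-end v)              ≡⟨ lookup∘update (outer-end v) t₀ (just true) ⟩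
          just true                            ∎)
      }
      where
      open ≡-Reasoning
      t₀ = replicate (n G) nothing
      t₁ = t₀ [ outer-end v ]≔ just true
      t₂ = t₁ [ v ]≔ just true
      inner-end≢ : inner-end v ≢ v
      inner-end≢ = opposite-≢ G (proj₂ (inner-spec mid-v))
      outer-end≢ : outer-end v ≢ v
      outer-end≢ = opposite-≢ G (proj₂ (outer-spec mid-v))

    module _ {c : Vec Bool (n G)} {u w : Fin (n G)} (good-u : Good c u) (good-w : Good c w)
             (u≢w : u ≢ w) where

      open Good

      private
        colours-≢ : ∀ {a b} → lookup c a ≡ true → lookup c b ≡ false → a ≢ b
        colours-≢ ca≡true cb≡false refl = contradiction (trans (sym ca≡true) cb≡false) λ ()

      inner-≢ : inner u ≢ inner w
      inner-≢ iu≡iw with Inc⇒≡∨≡opposite G (proj₂ (inner-spec (mid-vertex good-u)))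
                           (subst (Inc G w) (sym iu≡iw) (proj₂ (inner-spec (mid-vertex good-w))))
      ... | inj₁ w≡u   = u≢w (sym w≡u)
      ... | inj₂ w≡end = colours-≢ (self-true good-w) (inner-end-false good-u) w≡end

      outer-≢ : w ≢ outer-end u → outer u ≢ outer w
      outer-≢ w≢end ou≡ow with Inc⇒≡∨≡opposite G (proj₂ (outer-spec (mid-vertex good-u)))
                                  (subst (Inc G w) (sym ou≡ow) (proj₂ (outer-spec (mid-vertex good-w))))
      ... | inj₁ w≡u   = u≢w (sym w≡u)
      ... | inj₂ w≡end = w≢end w≡end

      inner-outer-¬adjacent : u ≢ outer-end w → ¬ LAdj G (inner u) (outer w)
      inner-outer-¬adjacent u≢end (_ , z , z∈iu , z∈ow)
        with Inc⇒≡∨≡opposite G (proj₂ (inner-spec (mid-vertex good-u))) z∈iu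
           | Inc⇒≡∨≡opposite G (proj₂ (outer-spec (mid-vertex good-w))) z∈ow
      ... | inj₁ z≡u  | inj₁ z≡w  = u≢w (trans (sym z≡u) z≡w)
      ... | inj₁ z≡u  | inj₂ z≡ow = u≢end (trans (sym z≡u) z≡ow)
      ... | inj₂ z≡iu | inj₁ z≡w  =
        colours-≢ (self-true good-w) (inner-end-false good-u) (trans (sym z≡w) z≡iu)
      ... | inj₂ z≡iu | inj₂ z≡ow =
        colours-≢ (outer-end-true good-w) (inner-end-false good-u) (trans (sym z≡ow) z≡iu)

    inducedCutMatching : ∀ {c T} → Unique T → Independent outer-end T → (∀ {v} → v ∈ T → Good c v) →
      IsInducedCutMatching (LineGraph G) X (length T)
    inducedCutMatching {T = T} T! T-indep good = inner ∘ vertex , outer ∘ vertex , edge , induced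
      where
      vertex = List.lookup T
      edge : ∀ i → inner (vertex i) ∈ₛ X × outer (vertex i) ∉ₛ X
                 × LAdj G (inner (vertex i)) (outer (vertex i))
      edge i = inner∈X , outer∉X , (λ eq → outer∉X (subst (_∈ₛ X) eq inner∈X))
             , vertex i , proj₂ (inner-spec mid-i) , proj₂ (outer-spec mid-i)
        where
        mid-i   = Good.mid-vertex (good (∈-lookup i))
        inner∈X = proj₁ (inner-spec mid-i)
        outer∉X = proj₁ (outer-spec mid-i)
      induced : ∀ i j → i ≢ j → inner (vertex i) ≢ inner (vertex j) × outer (vertex i) ≢ outer (vertex j)
                              × ¬ LAdj G (inner (vertex i)) (outer (vertex j))
      induced i j i≢j =
          inner-≢ good-i good-j u≢w
        , outer-≢ good-i good-j u≢w (λ w≡end → T-indep (∈-lookup i) (subst (_∈ T) w≡end (∈-lookup j)))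
        , inner-outer-¬adjacent good-i good-j u≢w
            (λ u≡end → T-indep (∈-lookup j) (subst (_∈ T) u≡end (∈-lookup i)))
        where
        good-i = good (∈-lookup i)
        good-j = good (∈-lookup j)
        u≢w = i≢j ∘ lookup-injective T!

    goodList : Vec Bool (n G) → List (Fin (n G))
    goodList c = filter (λ v → extends c (constraint v) ≟ᵇ true) midList

    ∈-goodList⇒Good : ∀ {c v} → v ∈ goodList c → Good c v
    ∈-goodList⇒Good {c} v∈ with ∈-filter⁻ (λ v → extends c (constraint v) ≟ᵇ true) {xs = midList} v∈
    ... | v∈mid , c⊒v = extends-constraint⇒Good c (∈-midList⁻ v∈mid) c⊒v

    ∃-large-inducedCutMatching′ : ∃ λ k → IsInducedCutMatching (LineGraph G) X k × length midList ≤ 24 * k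
    ∃-large-inducedCutMatching′ with ∃-colouring-extending-eighth constraint #fixed-constraint midList
    ... | c , ≤8·good
      with ∃-independent-third _≟_ outer-end (goodList c)
             (filter⁺ (λ v → extends c (constraint v) ≟ᵇ true) (filter⁺ midVertex? (allFin⁺ (n G))))
             (λ v∈ → opposite-≢ G (proj₂ (outer-spec (Good.mid-vertex (∈-goodList⇒Good {c} v∈)))))
    ... | T , T⊆good , T! , T-indep , ≤3·T =
      length T , inducedCutMatching T! T-indep (∈-goodList⇒Good {c} ∘ T⊆good) , (begin
        length midList           ≤⟨ ≤8·good ⟩
        8 * length (goodList c)  ≤⟨ *-monoʳ-≤ 8 ≤3·T ⟩
        8 * (3 * length T)       ≡⟨ sym (*-assoc 8 3 (length T)) ⟩
        24 * length T            ∎)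
      where open ≤-Reasoning

  ∃-large-inducedCutMatching : ∃ λ k → IsInducedCutMatching (LineGraph G) X k × length midList ≤ 24 * k
  ∃-large-inducedCutMatching = from ([]-or-∈ midList)
    where
    from : midList ≡ [] ⊎ ∃ (_∈ midList) →
      ∃ λ k → IsInducedCutMatching (LineGraph G) X k × length midList ≤ 24 * k
    from (inj₁ midList≡[])   =
      0 , emptyInducedCutMatching (LineGraph G) X , ≤-reflexive (cong length midList≡[])
    from (inj₂ (v , v∈mid)) = ∃-large-inducedCutMatching′ (proj₁ (proj₁ (∈-midList⁻ v∈mid)))

  ∣mid∣≤25*cutMim : ∀ {k} → CutMim (LineGraph G) X k → ∣ mid G X ∣ ≤ 25 * k
  ∣mid∣≤25*cutMim {k} (_ , maximal) =
    let k₀ , matching , ≤24k₀ = ∃-large-inducedCutMatching in begin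
      ∣ mid G X ∣     ≡⟨ ∣mid∣≡length-midList ⟩
      length midList  ≤⟨ ≤24k₀ ⟩
      24 * k₀         ≤⟨ *-monoʳ-≤ 24 (maximal k₀ matching) ⟩
      24 * k          ≤⟨ *-monoˡ-≤ k (n≤1+n 24) ⟩
      25 * k          ∎
    where open ≤-Reasoning

∃-function? : ∀ {N k} {P : (Fin k → Fin N) → Set} → (∀ {f g} → f ≗ g → P f → P g) →
  Decidable P → Dec (∃ P)
∃-function? {N} {zero}  resp P? = map′ (λ P∅ → ∅ , P∅) (λ (f , Pf) → resp (λ ()) Pf) (P? ∅)
  where
  ∅ : Fin 0 → Fin N
  ∅ ()
∃-function? {k = suc k} resp P? = map′
  (λ (a , f , Pa∷f) → a Vector.∷ f , Pa∷f)
  (λ (f , Pf) → Vector.head f , Vector.tail f , resp (λ { zero → refl ; (suc _) → refl }) Pf)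
  (any? λ a → ∃-function? (λ f≗g → resp λ { zero → refl ; (suc i) → f≗g i })
                          (λ f → P? (a Vector.∷ f)))

∃-greatest : ∀ {P : ℕ → Set} → Decidable P → P 0 → ∀ B → (∀ k → P k → k ≤ B) →
  ∃ λ k → P k × (∀ k′ → P k′ → k′ ≤ k)
∃-greatest P? P0 zero    bound = 0 , P0 , bound
∃-greatest P? P0 (suc B) bound with P? (suc B)
... | yes P[1+B] = suc B , P[1+B] , bound
... | no ¬P[1+B] = ∃-greatest P? P0 B λ k Pk → ≤-pred (≤∧≢⇒< (bound k Pk) λ { refl → ¬P[1+B] Pk })

module _ (H : AdjGraph) (A? : ∀ a b → Dec (A H a b)) (X : Subset (N H)) where

  private
    Conditions : ∀ {k} → (Fin k → Fin (N H)) → (Fin k → Fin (N H)) → Set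
    Conditions x y = (∀ i → x i ∈ₛ X × y i ∉ₛ X × A H (x i) (y i))
                   × (∀ i j → i ≢ j → x i ≢ x j × y i ≢ y j × ¬ A H (x i) (y j))

    conditions? : ∀ {k} x y → Dec (Conditions {k} x y)
    conditions? x y =
            all? (λ i → (x i ∈ₛ? X) ×-dec ¬? (y i ∈ₛ? X) ×-dec A? (x i) (y i))
      ×-dec all? (λ i → all? λ j → ¬? (i ≟ j) →-dec
                   (¬? (x i ≟ x j) ×-dec ¬? (y i ≟ y j) ×-dec ¬? (A? (x i) (y j))))

    conditions-resp : ∀ {k} {x x′ y y′ : Fin k → Fin (N H)} → x ≗ x′ → y ≗ y′ →
      Conditions x y → Conditions x′ y′
    conditions-resp x≗x′ y≗y′ (edges , induced) =
        (λ i → edge-resp (x≗x′ i) (y≗y′ i) (edges i))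
      , (λ i j i≢j → pair-resp (x≗x′ i) (x≗x′ j) (y≗y′ i) (y≗y′ j) (induced i j i≢j))
      where
      edge-resp : ∀ {a a′ b b′} → a ≡ a′ → b ≡ b′ →
        a ∈ₛ X × b ∉ₛ X × A H a b → a′ ∈ₛ X × b′ ∉ₛ X × A H a′ b′
      edge-resp refl refl edge = edge
      pair-resp : ∀ {a a′ b b′ c c′ d d′} → a ≡ a′ → b ≡ b′ → c ≡ c′ → d ≡ d′ →
        a ≢ b × c ≢ d × ¬ A H a d → a′ ≢ b′ × c′ ≢ d′ × ¬ A H a′ d′
      pair-resp refl refl refl refl pair = pair

  inducedCutMatching? : ∀ k → Dec (IsInducedCutMatching H X k)
  inducedCutMatching? k =
    ∃-function? (λ x≗x′ (y , C) → y , conditions-resp x≗x′ (λ _ → refl) C)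
                (λ x → ∃-function? (conditions-resp (λ _ → refl)) (conditions? x))

  inducedCutMatching⇒≤N : ∀ {k} → IsInducedCutMatching H X k → k ≤ N H
  inducedCutMatching⇒≤N (x , _ , _ , induced) = injective⇒≤ x-injective
    where
    x-injective : ∀ {i j} → x i ≡ x j → i ≡ j
    x-injective {i} {j} xi≡xj with i ≟ j
    ... | yes i≡j = i≡j
    ... | no i≢j  = contradiction xi≡xj (proj₁ (induced i j i≢j))

  ∃-cutMim : ∃ (CutMim H X)
  ∃-cutMim = ∃-greatest inducedCutMatching? (emptyInducedCutMatching H X) (N H)
                        (λ _ → inducedCutMatching⇒≤N)

-- Comparing branch-widths

branchWidth-≤ : ∀ {s} {F F′ : Subset s → ℕ → Set} {w w′} (h : ℕ → ℕ) → h Preserves _≤_ ⟶ _≤_ →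
  (∀ X → ∃ (F′ X)) → (∀ {X a b} → F X a → F′ X b → a ≤ h b) →
  IsBranchWidth s F w → IsBranchWidth s F′ w′ → w ≤ h w′
branchWidth-≤ {s} h h-mono F′-total F≤hF′ (small , large) (small′ , large′) with s ≤? 1
... | yes s≤1 = F≤hF′ (small s≤1) (small′ s≤1)
... | no s≰1 with proj₁ (large′ (≰⇒> s≰1))
...   | D′ , D′-bounded with proj₂ (large (≰⇒> s≰1)) D′
...     | e , X , k , e↦X , Fk , w≤k with F′-total X
...       | k′ , F′k′ = ≤-trans w≤k (≤-trans (F≤hF′ Fk F′k′) (h-mono (D′-bounded e X k′ e↦X F′k′)))

theorem1p4 : (G : Graph) (b w : ℕ) → IsBW G b → IsMimw (LineGraph G) w →
    (b ≤ 25 * w) × (w ≤ b)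
theorem1p4 G b w bw mimw =
    branchWidth-≤ (25 *_) (*-monoʳ-≤ 25) (∃-cutMim (LineGraph G) (LAdj? G))
                  (λ { {X} refl cutMim → ∣mid∣≤25*cutMim G X cutMim }) bw mimw
  , branchWidth-≤ (λ k → k) (λ k≤k′ → k≤k′) (λ X → ∣ mid G X ∣ , refl)
                  (λ { {X} cutMim refl → inducedCutMatching⇒≤∣mid∣ G X (proj₁ cutMim) }) mimw bw
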